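{- For every integer $r\geq 1$, there exists a connected graph $G$ with an edge $e$ such that deleting $e$ preserves connectivity and increases the gonality of $G$ by exactly $r$: $\operatorname{gon}(G-e)=\operatorname{gon}(G)+r$.
   Context: Graphs are finite, connected, undirected, loopless multigraphs. $\operatorname{gon}(G)$ denotes the divisorial gonality of $G$, i.e. the minimum degree of a divisor of positive rank in the chip-firing (Baker–Norine) divisor theory on $G$. -}

module Defs where

open import Data.Nat using (ℕ; zero; suc; _≤_)
open import Data.Integer as ℤ using (ℤ; +_; _-_; 0ℤ)
open import Data.Fin using (Fin; _≟_)
open import Data.Product using (_×_; _,_; Σ; ∃; ∃-syntax)
open import Data.List using (List; []; _∷_; length; removeAt)
open import Data.List.Relation.Unary.All using (All)
open import Relation.Binary.PropositionalEquality using (_≡_; _≢_)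
open import Relation.Nullary using (yes; no)

-- A multigraph on the vertex set Fin n, given by its list of edges
-- (each edge is an unordered pair, stored as an ordered pair; parallel
-- edges are repeated list entries).
MultiGraph : ℕ → Set
MultiGraph n = List (Fin n × Fin n)

Loopless : ∀ {n} → MultiGraph n → Set
Loopless G = All (λ e → Data.Product.proj₁ e ≢ Data.Product.proj₂ e) G

data _∈ᴱ_ {n : ℕ} : Fin n × Fin n → MultiGraph n → Set where
  here  : ∀ {e G} → e ∈ᴱ (e ∷ G)
  there : ∀ {e e' G} → e ∈ᴱ G → e ∈ᴱ (e' ∷ G)

data Reach {n : ℕ} (G : MultiGraph n) : Fin n → Fin n → Set where
  rfl  : ∀ {u} → Reach G u u
  fwd  : ∀ {u v w} → (u , v) ∈ᴱ G → Reach G v w → Reach G u w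
  bwd  : ∀ {u v w} → (v , u) ∈ᴱ G → Reach G v w → Reach G u w

Connected : ∀ {n} → MultiGraph n → Set
Connected {n} G = (u v : Fin n) → Reach G u v

deleteEdge : ∀ {n} (G : MultiGraph n) → Fin (length G) → MultiGraph n
deleteEdge G i = removeAt G i

Divisor : ℕ → Set
Divisor n = Fin n → ℤ

ΣFin : (n : ℕ) → (Fin n → ℤ) → ℤ
ΣFin zero    f = 0ℤ
ΣFin (suc n) f = f Fin.zero ℤ.+ ΣFin n (λ i → f (Fin.suc i))

deg : ∀ {n} → Divisor n → ℤ
deg {n} D = ΣFin n D

Effective : ∀ {n} → Divisor n → Set
Effective D = ∀ v → 0ℤ ℤ.≤ D v

-- Laplacian applied to a firing script f : (L f)(v) = Σ_{edges vw} (f v - f w).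
laplacian : ∀ {n} → MultiGraph n → (Fin n → ℤ) → Divisor n
laplacian []            f v = 0ℤ
laplacian ((a , b) ∷ G) f v = contrib a b ℤ.+ contrib b a ℤ.+ laplacian G f v
  where
  contrib : _ → _ → ℤ
  contrib x y with x ≟ v
  ... | yes _ = f x - f y
  ... | no  _ = 0ℤ

LinEquiv : ∀ {n} → MultiGraph n → Divisor n → Divisor n → Set
LinEquiv {n} G D D' = ∃[ f ] (∀ v → D' v ≡ D v - laplacian G f v)

minusVertex : ∀ {n} → Divisor n → Fin n → Divisor n
minusVertex D v w with v ≟ w
... | yes _ = D w - + 1
... | no  _ = D w

PositiveRank : ∀ {n} → MultiGraph n → Divisor n → Set
PositiveRank {n} G D = (v : Fin n) → ∃[ E ] (Effective E × LinEquiv G (minusVertex D v) E)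

IsGonality : ∀ {n} → MultiGraph n → ℕ → Set
IsGonality {n} G k =
  (∃[ D ] (PositiveRank G D × deg D ≡ + k)) ×
  (∀ (D : Divisor n) → PositiveRank G D → + k ℤ.≤ deg D)

-- The graph H has a vertex X joined by g = 2h parallel edges to each of m = 3h pendant
-- vertices Z i and by one edge to P, a bundle of m edges between P and Q, and m vertices W j
-- joined to both P and Q by h edges each; G is H plus an edge X–Q.
--
-- In G the divisor g(X) has positive rank: firing X and the Z's sends a chip
-- along X–P and X–Q at once, and after h such firings P and Q together can feed any W j.
-- In H the X-side reaches Q only through P, and g(X) + h(Q) has positive rank.
--
-- If D - (v) - L f is effective, summing D - L f over an upper level set of f
-- shows that every edge leaving that set costs a chip. A divisor of degree below g leaves
-- some Z i empty, and a script reaching Z i separates its g edges to X, so gon G ≥ g.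
-- In H, when deg D < m no such script separates the m-edge bundle P–Q, so every script
-- fires P and Q equally. The script reaching an empty Z i then leaves at least g - hρ chips
-- on X, P and the Z's, where ρ is the total rise of the script from P to the W's, while Q
-- and the W's carry at least 2hρ chips and, by a script reaching an empty W j, at least h.
-- Either sign of ρ gives deg D ≥ g + h.

module Submission where

open import Defs
import Data.Nat as ℕ

module ChipFiring where

  open ℕ using (ℕ; zero; suc)
  open import Data.Integer
    using (ℤ; +_; 0ℤ; 1ℤ; -1ℤ; _+_; _-_; -_; _*_; _≤_; _<_; _≤?_; +≤+)
  import Data.Integer.Properties as ℤ
  open import Data.Integer.Tactic.RingSolver using (solve-∀)
  open import Data.Fin using (Fin; zero; suc; _≟_; _↑ˡ_; _↑ʳ_)
  open import Data.Fin.Properties using (any?; suc-injective)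
  open import Data.List using ([]; _∷_; _++_; replicate)
  open import Data.List.Relation.Binary.Sublist.Propositional using (_⊆_; []; _∷_; _∷ʳ_; ⊆-refl)
  open import Data.List.Relation.Binary.Sublist.Propositional.Properties using (++⁺ˡ; ++⁺ʳ)
  open import Data.List.Relation.Unary.All using ([])
  import Data.List.Relation.Unary.All.Properties as All
  open import Data.Product using (_×_; _,_; ∃)
  open import Data.Sum using (_⊎_; inj₁; inj₂)
  open import Function using (_∘_)
  open import Relation.Nullary using (yes; no; contradiction)
  open import Relation.Binary.Definitions using (tri<; tri≈; tri>)
  open import Relation.Binary.PropositionalEquality
    using (_≡_; _≢_; refl; sym; trans; cong; cong₂; subst; module ≡-Reasoning)

  private
    variable
      n : ℕ

  nonneg-* : ∀ {a b : ℤ} → 0ℤ ≤ a → 0ℤ ≤ b → 0ℤ ≤ a * b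
  nonneg-* {+ a} {+ b} _ _ = subst (0ℤ ≤_) (ℤ.pos-* a b) (+≤+ ℕ.z≤n)

  ≤-by-gap : ∀ {a b : ℤ} c → 0ℤ ≤ c → a + c ≡ b → a ≤ b
  ≤-by-gap {a} c 0≤c refl = subst (_≤ a + c) (ℤ.+-identityʳ a) (ℤ.+-monoʳ-≤ a 0≤c)

  ≤-half : ∀ {t d : ℤ} → 0ℤ ≤ d → t + t ≤ d → t ≤ d
  ≤-half {t} {d} 0≤d t+t≤d with 0ℤ ≤? t
  ... | yes 0≤t = ℤ.≤-trans (subst (_≤ t + t) (ℤ.+-identityˡ t) (ℤ.+-monoˡ-≤ t 0≤t)) t+t≤d
  ... | no  0≰t = ℤ.≤-trans (ℤ.<⇒≤ (ℤ.≰⇒> 0≰t)) 0≤d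

  ≤-0-minus : ∀ {k l d : ℤ} → d ≡ 0ℤ → l ≤ - k → k ≤ d - l
  ≤-0-minus {k} {l} refl l≤-k = begin
    k       ≡⟨ sym (ℤ.neg-involutive k) ⟩
    - - k   ≤⟨ ℤ.neg-mono-≤ l≤-k ⟩
    - l     ≡⟨ sym (ℤ.+-identityˡ (- l)) ⟩
    0ℤ - l  ∎
    where open ℤ.≤-Reasoning

  *-negative⇒≤-1 : ∀ k {t} → + k * t < 0ℤ → t ≤ -1ℤ
  *-negative⇒≤-1 k {t} kt<0 =
    ℤ.i<j⇒i≤pred[j] (ℤ.*-cancelˡ-<-nonNeg (+ k) (subst (+ k * t <_) (sym (ℤ.*-zeroʳ (+ k))) kt<0))

  *-negative⇒≤-k : ∀ k {t} → + k * t < 0ℤ → + k * t ≤ - + k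
  *-negative⇒≤-k k {t} kt<0 =
    subst (+ k * t ≤_) (trans (ℤ.*-comm (+ k) -1ℤ) (ℤ.-1*i≡-i (+ k)))
          (ℤ.*-monoˡ-≤-nonNeg (+ k) (*-negative⇒≤-1 k kt<0))

  t+t<0⇒t<0 : ∀ {t : ℤ} → t + t < 0ℤ → t < 0ℤ
  t+t<0⇒t<0 {t} t+t<0 with 0ℤ ≤? t
  ... | yes 0≤t = contradiction (ℤ.+-mono-≤ 0≤t 0≤t) (ℤ.<⇒≱ t+t<0)
  ... | no  0≰t = ℤ.≰⇒> 0≰t

  multiple-dichotomy : ∀ k x → + k * x ≤ 0ℤ ⊎ + k ≤ + k * x
  multiple-dichotomy k x with x ≤? 0ℤ
  ... | yes x≤0 = inj₁ (subst (+ k * x ≤_) (ℤ.*-zeroʳ (+ k)) (ℤ.*-monoˡ-≤-nonNeg (+ k) x≤0))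
  ... | no  x≰0 = inj₂ (subst (_≤ + k * x) (ℤ.*-identityʳ (+ k)) (ℤ.*-monoˡ-≤-nonNeg (+ k) (ℤ.i<j⇒suc[i]≤j (ℤ.≰⇒> x≰0))))

  ΣFin-cong : ∀ n {f g : Fin n → ℤ} → (∀ i → f i ≡ g i) → ΣFin n f ≡ ΣFin n g
  ΣFin-cong zero    f≗g = refl
  ΣFin-cong (suc n) f≗g = cong₂ _+_ (f≗g zero) (ΣFin-cong n (f≗g ∘ suc))

  ΣFin-+ : ∀ n (f g : Fin n → ℤ) → ΣFin n (λ i → f i + g i) ≡ ΣFin n f + ΣFin n g
  ΣFin-+ zero    f g = refl
  ΣFin-+ (suc n) f g =
    trans (cong (_+_ (f zero + g zero)) (ΣFin-+ n (f ∘ suc) (g ∘ suc)))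
          (interchange (f zero) (g zero) (ΣFin n (f ∘ suc)) (ΣFin n (g ∘ suc)))
    where
    interchange : ∀ a b c d → (a + b) + (c + d) ≡ (a + c) + (b + d)
    interchange = solve-∀

  ΣFin-minus : ∀ n (f g : Fin n → ℤ) → ΣFin n (λ i → f i - g i) ≡ ΣFin n f - ΣFin n g
  ΣFin-minus zero    f g = refl
  ΣFin-minus (suc n) f g =
    trans (cong (_+_ (f zero - g zero)) (ΣFin-minus n (f ∘ suc) (g ∘ suc)))
          (interchange (f zero) (g zero) (ΣFin n (f ∘ suc)) (ΣFin n (g ∘ suc)))
    where
    interchange : ∀ a b c d → (a - b) + (c - d) ≡ (a + c) - (b + d)
    interchange = solve-∀

  ΣFin-* : ∀ n c (f : Fin n → ℤ) → ΣFin n (λ i → c * f i) ≡ c * ΣFin n f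
  ΣFin-* zero    c f = sym (ℤ.*-zeroʳ c)
  ΣFin-* (suc n) c f =
    trans (cong (_+_ (c * f zero)) (ΣFin-* n c (f ∘ suc))) (sym (ℤ.*-distribˡ-+ c (f zero) _))

  ΣFin-const : ∀ n c → ΣFin n (λ _ → c) ≡ + n * c
  ΣFin-const zero    c = refl
  ΣFin-const (suc n) c = trans (cong (_+_ c) (ΣFin-const n c)) (sym (ℤ.suc-* (+ n) c))

  ΣFin-zero : ∀ n {f : Fin n → ℤ} → (∀ i → f i ≡ 0ℤ) → ΣFin n f ≡ 0ℤ
  ΣFin-zero n f≗0 = trans (ΣFin-cong n f≗0) (trans (ΣFin-const n 0ℤ) (ℤ.*-zeroʳ (+ n)))

  ΣFin-mono-≤ : ∀ n {f g : Fin n → ℤ} → (∀ i → f i ≤ g i) → ΣFin n f ≤ ΣFin n g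
  ΣFin-mono-≤ zero    f≤g = ℤ.≤-refl
  ΣFin-mono-≤ (suc n) f≤g = ℤ.+-mono-≤ (f≤g zero) (ΣFin-mono-≤ n (f≤g ∘ suc))

  ΣFin-nonneg : ∀ n {f : Fin n → ℤ} → (∀ i → 0ℤ ≤ f i) → 0ℤ ≤ ΣFin n f
  ΣFin-nonneg n {f} 0≤f =
    subst (_≤ ΣFin n f) (ΣFin-zero n (λ _ → refl)) (ΣFin-mono-≤ n 0≤f)

  ΣFin-≥-term : ∀ n {f : Fin n → ℤ} → (∀ i → 0ℤ ≤ f i) → ∀ j → f j ≤ ΣFin n f
  ΣFin-≥-term (suc n) {f} 0≤f zero =
    subst (_≤ ΣFin (suc n) f) (ℤ.+-identityʳ (f zero)) (ℤ.+-monoʳ-≤ (f zero) (ΣFin-nonneg n (0≤f ∘ suc)))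
  ΣFin-≥-term (suc n) {f} 0≤f (suc j) =
    subst (_≤ ΣFin (suc n) f) (ℤ.+-identityˡ (f (suc j))) (ℤ.+-mono-≤ (0≤f zero) (ΣFin-≥-term n (0≤f ∘ suc) j))

  ΣFin-↑ : ∀ a b (f : Fin (a ℕ.+ b) → ℤ) → ΣFin (a ℕ.+ b) f ≡ ΣFin a (f ∘ (_↑ˡ b)) + ΣFin b (f ∘ (a ↑ʳ_))
  ΣFin-↑ zero    b f = sym (ℤ.+-identityˡ _)
  ΣFin-↑ (suc a) b f = trans (cong (_+_ (f zero)) (ΣFin-↑ a b (f ∘ suc))) (sym (ℤ.+-assoc (f zero) _ _))

  ΣFin-zero-or-≥ : ∀ n {f : Fin n → ℤ} → (∀ i → 0ℤ ≤ f i) → (∃ λ i → f i ≡ 0ℤ) ⊎ (+ n ≤ ΣFin n f)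
  ΣFin-zero-or-≥ n {f} 0≤f with any? (λ i → f i ℤ.≟ 0ℤ)
  ... | yes zero-entry = inj₁ zero-entry
  ... | no  no-zero    = inj₂ (subst (_≤ ΣFin n f) (trans (ΣFin-const n 1ℤ) (ℤ.*-identityʳ (+ n))) (ΣFin-mono-≤ n 1≤f))
    where
    1≤f : ∀ i → 1ℤ ≤ f i
    1≤f i = ℤ.i<j⇒suc[i]≤j (ℤ.≤∧≢⇒< (0≤f i) (λ 0≡fi → no-zero (i , sym 0≡fi)))

  δ : Fin n → Divisor n
  δ a v with a ≟ v
  ... | yes _ = 1ℤ
  ... | no  _ = 0ℤ

  δ-same : ∀ (a : Fin n) → δ a a ≡ 1ℤ
  δ-same a with a ≟ a
  ... | yes _   = refl
  ... | no  a≢a = contradiction refl a≢a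

  δ-other : ∀ {a v : Fin n} → a ≢ v → δ a v ≡ 0ℤ
  δ-other {a = a} {v} a≢v with a ≟ v
  ... | yes a≡v = contradiction a≡v a≢v
  ... | no  _   = refl

  δ-sym : ∀ (a v : Fin n) → δ a v ≡ δ v a
  δ-sym a v with a ≟ v
  ... | yes refl = sym (δ-same a)
  ... | no  a≢v  = sym (δ-other (a≢v ∘ sym))

  δ-injective : ∀ {k} {φ : Fin k → Fin n} → (∀ {i j} → φ i ≡ φ j → i ≡ j) → ∀ a v → δ (φ a) (φ v) ≡ δ a v
  δ-injective φ-inj a v with a ≟ v
  ... | yes refl = δ-same _
  ... | no  a≢v  = δ-other (a≢v ∘ φ-inj)

  δ-nonneg : ∀ (a v : Fin n) → 0ℤ ≤ δ a v
  δ-nonneg a v with a ≟ v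
  ... | yes _ = +≤+ ℕ.z≤n
  ... | no  _ = ℤ.≤-refl

  ΣFin-*-δ : ∀ n (w : Fin n → ℤ) (a : Fin n) → ΣFin n (λ v → w v * δ a v) ≡ w a
  ΣFin-*-δ (suc n) w zero = begin
    w zero * 1ℤ + ΣFin n (λ v → w (suc v) * 0ℤ)  ≡⟨ cong₂ _+_ (ℤ.*-identityʳ (w zero)) (ΣFin-zero n (ℤ.*-zeroʳ ∘ w ∘ suc)) ⟩
    w zero + 0ℤ                                  ≡⟨ ℤ.+-identityʳ (w zero) ⟩
    w zero                                       ∎
    where open ≡-Reasoning
  ΣFin-*-δ (suc n) w (suc a) = begin
    w zero * 0ℤ + ΣFin n (λ v → w (suc v) * δ (suc a) (suc v))  ≡⟨ cong₂ _+_ (ℤ.*-zeroʳ (w zero)) (ΣFin-cong n λ v → cong (w (suc v) *_) (δ-injective suc-injective a v)) ⟩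
    0ℤ + ΣFin n (λ v → w (suc v) * δ a v)                       ≡⟨ ℤ.+-identityˡ _ ⟩
    ΣFin n (λ v → w (suc v) * δ a v)                            ≡⟨ ΣFin-*-δ n (w ∘ suc) a ⟩
    w (suc a)                                                   ∎
    where open ≡-Reasoning

  ΣFin-δ : ∀ n (a : Fin n) → ΣFin n (δ a) ≡ 1ℤ
  ΣFin-δ n a = trans (ΣFin-cong n (sym ∘ ℤ.*-identityˡ ∘ δ a)) (ΣFin-*-δ n (λ _ → 1ℤ) a)

  laplacian-∷ : ∀ a b (G : MultiGraph n) f v →
    laplacian ((a , b) ∷ G) f v ≡ (f a - f b) * δ a v + (f b - f a) * δ b v + laplacian G f v
  laplacian-∷ a b G f v with a ≟ v | b ≟ v
  ... | yes _ | yes _ = cong₂ (λ s t → s + t + laplacian G f v) (sym (ℤ.*-identityʳ (f a - f b))) (sym (ℤ.*-identityʳ (f b - f a)))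
  ... | yes _ | no  _ = cong₂ (λ s t → s + t + laplacian G f v) (sym (ℤ.*-identityʳ (f a - f b))) (sym (ℤ.*-zeroʳ (f b - f a)))
  ... | no  _ | yes _ = cong₂ (λ s t → s + t + laplacian G f v) (sym (ℤ.*-zeroʳ (f a - f b))) (sym (ℤ.*-identityʳ (f b - f a)))
  ... | no  _ | no  _ = cong₂ (λ s t → s + t + laplacian G f v) (sym (ℤ.*-zeroʳ (f a - f b))) (sym (ℤ.*-zeroʳ (f b - f a)))

  laplacian-++ : ∀ (G G′ : MultiGraph n) f v → laplacian (G ++ G′) f v ≡ laplacian G f v + laplacian G′ f v
  laplacian-++ []            G′ f v = sym (ℤ.+-identityˡ _)
  laplacian-++ ((a , b) ∷ G) G′ f v = begin
    laplacian ((a , b) ∷ G ++ G′) f v            ≡⟨ laplacian-∷ a b (G ++ G′) f v ⟩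
    edge + laplacian (G ++ G′) f v               ≡⟨ cong (_+_ edge) (laplacian-++ G G′ f v) ⟩
    edge + (laplacian G f v + laplacian G′ f v)  ≡⟨ sym (ℤ.+-assoc edge (laplacian G f v) (laplacian G′ f v)) ⟩
    edge + laplacian G f v + laplacian G′ f v    ≡⟨ cong (_+ laplacian G′ f v) (sym (laplacian-∷ a b G f v)) ⟩
    laplacian ((a , b) ∷ G) f v + laplacian G′ f v ∎
    where
    open ≡-Reasoning
    edge : ℤ
    edge = (f a - f b) * δ a v + (f b - f a) * δ b v

  laplacian-replicate : ∀ k (a b : Fin n) f v →
    laplacian (replicate k (a , b)) f v ≡ + k * ((f a - f b) * δ a v + (f b - f a) * δ b v)
  laplacian-replicate zero    a b f v = refl
  laplacian-replicate (suc k) a b f v =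
    trans (laplacian-∷ a b (replicate k (a , b)) f v)
          (trans (cong (_+_ edge) (laplacian-replicate k a b f v)) (sym (ℤ.suc-* (+ k) edge)))
    where
    edge : ℤ
    edge = (f a - f b) * δ a v + (f b - f a) * δ b v

  laplacian-+ : ∀ (G : MultiGraph n) f f′ v → laplacian G (λ u → f u + f′ u) v ≡ laplacian G f v + laplacian G f′ v
  laplacian-+ []            f f′ v = refl
  laplacian-+ ((a , b) ∷ G) f f′ v = begin
    laplacian ((a , b) ∷ G) (λ u → f u + f′ u) v
      ≡⟨ laplacian-∷ a b G (λ u → f u + f′ u) v ⟩
    ((f a + f′ a) - (f b + f′ b)) * δ a v + ((f b + f′ b) - (f a + f′ a)) * δ b v + laplacian G (λ u → f u + f′ u) v
      ≡⟨ cong (_+_ (((f a + f′ a) - (f b + f′ b)) * δ a v + ((f b + f′ b) - (f a + f′ a)) * δ b v)) (laplacian-+ G f f′ v) ⟩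
    ((f a + f′ a) - (f b + f′ b)) * δ a v + ((f b + f′ b) - (f a + f′ a)) * δ b v + (laplacian G f v + laplacian G f′ v)
      ≡⟨ regroup (f a) (f′ a) (f b) (f′ b) (δ a v) (δ b v) (laplacian G f v) (laplacian G f′ v) ⟩
    ((f a - f b) * δ a v + (f b - f a) * δ b v + laplacian G f v) + ((f′ a - f′ b) * δ a v + (f′ b - f′ a) * δ b v + laplacian G f′ v)
      ≡⟨ sym (cong₂ _+_ (laplacian-∷ a b G f v) (laplacian-∷ a b G f′ v)) ⟩
    laplacian ((a , b) ∷ G) f v + laplacian ((a , b) ∷ G) f′ v
      ∎
    where
    open ≡-Reasoning
    regroup : ∀ x x′ y y′ α β l l′ →
      ((x + x′) - (y + y′)) * α + ((y + y′) - (x + x′)) * β + (l + l′) ≡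
      ((x - y) * α + (y - x) * β + l) + ((x′ - y′) * α + (y′ - x′) * β + l′)
    regroup = solve-∀

  laplacian-* : ∀ (G : MultiGraph n) c f v → laplacian G (λ u → c * f u) v ≡ c * laplacian G f v
  laplacian-* []            c f v = sym (ℤ.*-zeroʳ c)
  laplacian-* ((a , b) ∷ G) c f v = begin
    laplacian ((a , b) ∷ G) (λ u → c * f u) v
      ≡⟨ laplacian-∷ a b G (λ u → c * f u) v ⟩
    (c * f a - c * f b) * δ a v + (c * f b - c * f a) * δ b v + laplacian G (λ u → c * f u) v
      ≡⟨ cong (_+_ ((c * f a - c * f b) * δ a v + (c * f b - c * f a) * δ b v)) (laplacian-* G c f v) ⟩
    (c * f a - c * f b) * δ a v + (c * f b - c * f a) * δ b v + c * laplacian G f v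
      ≡⟨ factor c (f a) (f b) (δ a v) (δ b v) (laplacian G f v) ⟩
    c * ((f a - f b) * δ a v + (f b - f a) * δ b v + laplacian G f v)
      ≡⟨ cong (c *_) (sym (laplacian-∷ a b G f v)) ⟩
    c * laplacian ((a , b) ∷ G) f v
      ∎
    where
    open ≡-Reasoning
    factor : ∀ c x y α β l → (c * x - c * y) * α + (c * y - c * x) * β + c * l ≡ c * ((x - y) * α + (y - x) * β + l)
    factor = solve-∀

  laplacian-const : ∀ (G : MultiGraph n) c v → laplacian G (λ _ → c) v ≡ 0ℤ
  laplacian-const []            c v = refl
  laplacian-const ((a , b) ∷ G) c v =
    trans (laplacian-∷ a b G (λ _ → c) v)
          (trans (cong (_+_ ((c - c) * δ a v + (c - c) * δ b v)) (laplacian-const G c v)) (vanish c (δ a v) (δ b v)))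
    where
    vanish : ∀ c α β → (c - c) * α + (c - c) * β + 0ℤ ≡ 0ℤ
    vanish = solve-∀

  -- Summation by parts

  energy : MultiGraph n → (Fin n → ℤ) → (Fin n → ℤ) → ℤ
  energy []            w f = 0ℤ
  energy ((a , b) ∷ G) w f = (w a - w b) * (f a - f b) + energy G w f

  ΣFin-*-laplacian : ∀ (G : MultiGraph n) (w f : Fin n → ℤ) → ΣFin n (λ u → w u * laplacian G f u) ≡ energy G w f
  ΣFin-*-laplacian {n} []            w f = ΣFin-zero n (ℤ.*-zeroʳ ∘ w)
  ΣFin-*-laplacian {n} ((a , b) ∷ G) w f = begin
    ΣFin n (λ u → w u * laplacian ((a , b) ∷ G) f u)
      ≡⟨ ΣFin-cong n (λ u → trans (cong (w u *_) (laplacian-∷ a b G f u))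
                                  (spread (w u) (f a - f b) (f b - f a) (δ a u) (δ b u) (laplacian G f u))) ⟩
    ΣFin n (λ u → (f a - f b) * (w u * δ a u) + (f b - f a) * (w u * δ b u) + w u * laplacian G f u)
      ≡⟨ trans (ΣFin-+ n (λ u → (f a - f b) * (w u * δ a u) + (f b - f a) * (w u * δ b u)) (λ u → w u * laplacian G f u))
               (cong (_+ ΣFin n (λ u → w u * laplacian G f u)) (ΣFin-+ n (λ u → (f a - f b) * (w u * δ a u)) (λ u → (f b - f a) * (w u * δ b u)))) ⟩
    ΣFin n (λ u → (f a - f b) * (w u * δ a u)) + ΣFin n (λ u → (f b - f a) * (w u * δ b u))
      + ΣFin n (λ u → w u * laplacian G f u)
      ≡⟨ cong₂ _+_ (cong₂ _+_ (trans (ΣFin-* n (f a - f b) (λ u → w u * δ a u)) (cong ((f a - f b) *_) (ΣFin-*-δ n w a)))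
                               (trans (ΣFin-* n (f b - f a) (λ u → w u * δ b u)) (cong ((f b - f a) *_) (ΣFin-*-δ n w b))))
                   (ΣFin-*-laplacian G w f) ⟩
    (f a - f b) * w a + (f b - f a) * w b + energy G w f
      ≡⟨ cong (_+ energy G w f) (antisymmetrise (f a) (f b) (w a) (w b)) ⟩
    (w a - w b) * (f a - f b) + energy G w f
      ∎
    where
    open ≡-Reasoning
    spread : ∀ w x y α β l → w * (x * α + y * β + l) ≡ x * (w * α) + y * (w * β) + w * l
    spread = solve-∀
    antisymmetrise : ∀ x y p q → (x - y) * p + (y - x) * q ≡ (p - q) * (x - y)
    antisymmetrise = solve-∀

  energy-const : ∀ (G : MultiGraph n) c f → energy G (λ _ → c) f ≡ 0ℤ
  energy-const []            c f = refl
  energy-const ((a , b) ∷ G) c f =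
    cong₂ _+_ (cong (_* (f a - f b)) (ℤ.+-inverseʳ c)) (energy-const G c f)

  energy-replicate : ∀ k (a b : Fin n) w f → energy (replicate k (a , b)) w f ≡ + k * ((w a - w b) * (f a - f b))
  energy-replicate zero    a b w f = refl
  energy-replicate (suc k) a b w f =
    trans (cong (_+_ ((w a - w b) * (f a - f b))) (energy-replicate k a b w f)) (sym (ℤ.suc-* (+ k) _))

  energy-⊆ : ∀ {G′ G : MultiGraph n} w f → (∀ a b → 0ℤ ≤ (w a - w b) * (f a - f b)) →
    G′ ⊆ G → energy G′ w f ≤ energy G w f
  energy-⊆ w f nonneg []                  = ℤ.≤-refl
  energy-⊆ {G = (a , b) ∷ G} w f nonneg (_ ∷ʳ G′⊆G) =
    ℤ.≤-trans (energy-⊆ w f nonneg G′⊆G)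
              (subst (_≤ (w a - w b) * (f a - f b) + energy G w f) (ℤ.+-identityˡ (energy G w f))
                     (ℤ.+-monoˡ-≤ (energy G w f) (nonneg a b)))
  energy-⊆ {G = (a , b) ∷ G} w f nonneg (refl ∷ G′⊆G) =
    ℤ.+-monoʳ-≤ ((w a - w b) * (f a - f b)) (energy-⊆ w f nonneg G′⊆G)

  deg-laplacian : ∀ (G : MultiGraph n) f → deg (laplacian G f) ≡ 0ℤ
  deg-laplacian {n} G f =
    trans (ΣFin-cong n (sym ∘ ℤ.*-identityˡ ∘ laplacian G f))
          (trans (ΣFin-*-laplacian G (λ _ → 1ℤ) f) (energy-const G 1ℤ f))

  record Certificate (G : MultiGraph n) (D : Divisor n) (v : Fin n) (f : Fin n → ℤ) : Set where
    constructor certificate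
    field
      dominated : ∀ u → δ v u + laplacian G f u ≤ D u

  open Certificate public

  Certified : MultiGraph n → Divisor n → Set
  Certified G D = ∀ v → ∃ (Certificate G D v)

  minusVertex-laplacian : ∀ (G : MultiGraph n) D v f u →
    minusVertex D v u - laplacian G f u ≡ D u - (δ v u + laplacian G f u)
  minusVertex-laplacian G D v f u = trans (cong (_- laplacian G f u) (minusVertex≡ v u)) (sub-sub (D u) (δ v u) _)
    where
    minusVertex≡ : ∀ v u → minusVertex D v u ≡ D u - δ v u
    minusVertex≡ v u with v ≟ u
    ... | yes _ = refl
    ... | no  _ = sym (ℤ.+-identityʳ (D u))
    sub-sub : ∀ a b c → a - b - c ≡ a - (b + c)
    sub-sub = solve-∀

  certified⇒positiveRank : ∀ {G : MultiGraph n} {D} → Certified G D → PositiveRank G D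
  certified⇒positiveRank {G = G} {D} certs v with certs v
  ... | f , cert = (λ u → minusVertex D v u - laplacian G f u) , effective , f , (λ _ → refl)
    where
    effective : Effective (λ u → minusVertex D v u - laplacian G f u)
    effective u = subst (0ℤ ≤_) (sym (minusVertex-laplacian G D v f u)) (ℤ.i≤j⇒0≤j-i (dominated cert u))

  positiveRank⇒certified : ∀ {G : MultiGraph n} {D} → PositiveRank G D → Certified G D
  positiveRank⇒certified {G = G} {D} pr v with pr v
  ... | E , effective , f , E≡ =
    f , certificate λ u → ℤ.0≤i-j⇒j≤i (subst (0ℤ ≤_) (trans (E≡ u) (minusVertex-laplacian G D v f u)) (effective u))

  certificate-≤ : ∀ {G : MultiGraph n} {D v f} → Certificate G D v f → ∀ u → laplacian G f u ≤ D u
  certificate-≤ {G = G} {v = v} {f} cert u =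
    ℤ.≤-trans (subst (_≤ δ v u + laplacian G f u) (ℤ.+-identityˡ _) (ℤ.+-monoˡ-≤ (laplacian G f u) (δ-nonneg v u))) (dominated cert u)

  certificate-target : ∀ {G : MultiGraph n} {D v f} → Certificate G D v f → 1ℤ + laplacian G f v ≤ D v
  certificate-target {G = G} {v = v} {f} cert = subst (λ t → t + laplacian G f v ≤ _) (δ-same v) (dominated cert v)

  certificate-residual : ∀ {G : MultiGraph n} {D v f} → Certificate G D v f → ∀ u → 0ℤ ≤ D u - laplacian G f u
  certificate-residual cert u = ℤ.i≤j⇒0≤j-i (certificate-≤ cert u)

  certificate-empty-target : ∀ {G : MultiGraph n} {D v f} → Certificate G D v f → D v ≡ 0ℤ → laplacian G f v < 0ℤ
  certificate-empty-target {G = G} {v = v} {f} cert Dv≡0 =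
    ℤ.suc[i]≤j⇒i<j (subst (1ℤ + laplacian G f v ≤_) Dv≡0 (certificate-target cert))

  certificate-of-chip : ∀ {G : MultiGraph n} {D v} → Effective D → 1ℤ ≤ D v → Certificate G D v (λ _ → 0ℤ)
  certificate-of-chip {G = G} {D} {v} effective 1≤Dv = certificate λ u →
    subst (_≤ D u) (sym (trans (cong (_+_ (δ v u)) (laplacian-const G 0ℤ u)) (ℤ.+-identityʳ (δ v u)))) (δ≤D u)
    where
    δ≤D : ∀ u → δ v u ≤ D u
    δ≤D u with v ≟ u
    ... | yes refl = 1≤Dv
    ... | no  _    = effective u

  effective-representative : ∀ {G : MultiGraph n} {D} → Fin n → Certified G D →
    ∃ λ D′ → Effective D′ × Certified G D′ × deg D′ ≡ deg D
  effective-representative {n} {G} {D} v₀ certs with certs v₀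
  ... | f₀ , cert₀ = D′ , effective , certified , degree
    where
    L₀ : Divisor n
    L₀ = laplacian G f₀
    D′ : Divisor n
    D′ u = D u - L₀ u
    shift : ∀ {a b c} → a + b ≤ c → a ≤ c - b
    shift {a} {b} {c} a+b≤c = subst (_≤ c - b) (cancel a b) (ℤ.+-monoˡ-≤ (- b) a+b≤c)
      where
      cancel : ∀ a b → a + b - b ≡ a
      cancel = solve-∀
    effective : Effective D′
    effective u = ℤ.≤-trans (δ-nonneg v₀ u) (shift (dominated cert₀ u))
    certified : Certified G D′
    certified v with certs v
    ... | f , cert = (λ u → f u + -1ℤ * f₀ u) , certificate λ u → begin
      δ v u + laplacian G (λ u → f u + -1ℤ * f₀ u) u
        ≡⟨ cong (_+_ (δ v u)) (trans (laplacian-+ G f _ u) (cong (_+_ (laplacian G f u)) (laplacian-* G -1ℤ f₀ u))) ⟩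
      δ v u + (laplacian G f u + -1ℤ * L₀ u)
        ≡⟨ regroup (δ v u) (laplacian G f u) (L₀ u) ⟩
      δ v u + laplacian G f u - L₀ u
        ≤⟨ ℤ.+-monoˡ-≤ (- L₀ u) (dominated cert u) ⟩
      D′ u ∎
      where
      open ℤ.≤-Reasoning
      regroup : ∀ d l l₀ → d + (l + -1ℤ * l₀) ≡ d + l - l₀
      regroup = solve-∀
    degree : deg D′ ≡ deg D
    degree = trans (ΣFin-minus n D L₀) (trans (cong (_-_ (deg D)) (deg-laplacian G f₀)) (ℤ.+-identityʳ (deg D)))

  isGonality : ∀ {G : MultiGraph n} {k} → Fin n → (D₀ : Divisor n) → Certified G D₀ → deg D₀ ≡ + k →
    (∀ D → Effective D → Certified G D → + k ≤ deg D) → IsGonality G k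
  isGonality {G = G} {k} v₀ D₀ certs₀ deg≡k lower =
    (D₀ , certified⇒positiveRank {G = G} certs₀ , deg≡k) , bound
    where
    bound : ∀ D → PositiveRank G D → + k ≤ deg D
    bound D pr with effective-representative {G = G} v₀ (positiveRank⇒certified {G = G} pr)
    ... | D′ , effective , certs′ , deg≡ = subst (+ k ≤_) deg≡ (lower D′ effective certs′)

  above : ℤ → ℤ → ℤ
  above t x with t ≤? x
  ... | yes _ = 1ℤ
  ... | no  _ = 0ℤ

  above-*-≤ : ∀ t x {l d : ℤ} → l ≤ d → 0ℤ ≤ d → above t x * l ≤ d
  above-*-≤ t x {l} l≤d 0≤d with t ≤? x
  ... | yes _ = subst (_≤ _) (sym (ℤ.*-identityˡ l)) l≤d
  ... | no  _ = 0≤d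

  above-monotone : ∀ t x y → 0ℤ ≤ (above t x - above t y) * (x - y)
  above-monotone t x y with t ≤? x | t ≤? y
  ... | yes _   | yes _   = ℤ.≤-refl
  ... | no  _   | no  _   = ℤ.≤-refl
  ... | yes t≤x | no  t≰y =
    subst (0ℤ ≤_) (sym (ℤ.*-identityˡ (x - y))) (ℤ.i≤j⇒0≤j-i (ℤ.<⇒≤ (ℤ.<-≤-trans (ℤ.≰⇒> t≰y) t≤x)))
  ... | no  t≰x | yes t≤y =
    subst (0ℤ ≤_) (flip x y) (ℤ.i≤j⇒0≤j-i (ℤ.<⇒≤ (ℤ.<-≤-trans (ℤ.≰⇒> t≰x) t≤y)))
    where
    flip : ∀ x y → y - x ≡ (0ℤ - 1ℤ) * (x - y)
    flip = solve-∀

  above-separates : ∀ {x y} → y < x → 1ℤ ≤ (above x x - above x y) * (x - y)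
  above-separates {x} {y} y<x with x ≤? x | x ≤? y
  ... | no  x≰x | _       = contradiction ℤ.≤-refl x≰x
  ... | yes _   | yes x≤y = contradiction x≤y (ℤ.<⇒≱ y<x)
  ... | yes _   | no  _   =
    subst (_≤ 1ℤ * (x - y)) (one y) (ℤ.≤-trans (ℤ.+-monoˡ-≤ (- y) (ℤ.i<j⇒suc[i]≤j y<x)) (ℤ.≤-reflexive (sym (ℤ.*-identityˡ (x - y)))))
    where
    one : ∀ y → 1ℤ + y - y ≡ 1ℤ
    one = solve-∀

  separating-above : ∀ {x y} → x ≢ y → ∃ λ t → 1ℤ ≤ (above t x - above t y) * (x - y)
  separating-above {x} {y} x≢y with ℤ.<-cmp x y
  ... | tri< x<y _ _ = y , subst (1ℤ ≤_) (swap (above y y) (above y x) y x) (above-separates x<y)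
    where
    swap : ∀ s s′ y x → (s - s′) * (y - x) ≡ (s′ - s) * (x - y)
    swap = solve-∀
  ... | tri≈ _ x≡y _ = contradiction x≡y x≢y
  ... | tri> _ _ y<x = x , above-separates y<x

  -- Sum D - L f against the indicator of a level set {u | t ≤ f u} separating a from b.
  bundle-bound : ∀ {G : MultiGraph n} {D f k a b} → Effective D → (∀ u → laplacian G f u ≤ D u) →
    replicate k (a , b) ⊆ G → f a ≢ f b → + k ≤ deg D
  bundle-bound {n} {G} {D} {f} {k} {a} {b} effective L≤D bundle fa≢fb with separating-above fa≢fb
  ... | t , 1≤cut = begin
    + k                                        ≡⟨ sym (ℤ.*-identityʳ (+ k)) ⟩
    + k * 1ℤ                                   ≤⟨ ℤ.*-monoˡ-≤-nonNeg (+ k) 1≤cut ⟩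
    + k * ((w a - w b) * (f a - f b))          ≡⟨ sym (energy-replicate k a b w f) ⟩
    energy (replicate k (a , b)) w f           ≤⟨ energy-⊆ w f (λ a b → above-monotone t (f a) (f b)) bundle ⟩
    energy G w f                               ≡⟨ sym (ΣFin-*-laplacian G w f) ⟩
    ΣFin n (λ u → w u * laplacian G f u)       ≤⟨ ΣFin-mono-≤ n (λ u → above-*-≤ t (f u) (L≤D u) (effective u)) ⟩
    deg D                                      ∎
    where
    open ℤ.≤-Reasoning
    w : Fin n → ℤ
    w = above t ∘ f

  bundle-rigid : ∀ {G : MultiGraph n} {D f k a b} → Effective D → (∀ u → laplacian G f u ≤ D u) →
    replicate k (a , b) ⊆ G → deg D < + k → f a ≡ f b
  bundle-rigid {f = f} {a = a} {b} effective L≤D bundle deg<k with f a ℤ.≟ f b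
  ... | yes fa≡fb = fa≡fb
  ... | no  fa≢fb = contradiction (bundle-bound effective L≤D bundle fa≢fb) (ℤ.<⇒≱ deg<k)

  star : Fin n → (k : ℕ) → (Fin k → Fin n) → ℕ → MultiGraph n
  star c zero    φ t = []
  star c (suc k) φ t = replicate t (c , φ zero) ++ star c k (φ ∘ suc) t

  replicate⊆star : ∀ (c : Fin n) k φ t i → replicate t (c , φ i) ⊆ star c k φ t
  replicate⊆star c (suc k) φ t zero    = ++⁺ʳ (star c k (φ ∘ suc) t) ⊆-refl
  replicate⊆star c (suc k) φ t (suc i) = ++⁺ˡ (replicate t (c , φ zero)) (replicate⊆star c k (φ ∘ suc) t i)

  laplacian-star : ∀ (c : Fin n) k φ t f v → laplacian (star c k φ t) f v ≡
    ΣFin k (λ i → + t * ((f c - f (φ i)) * δ c v + (f (φ i) - f c) * δ (φ i) v))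
  laplacian-star c zero    φ t f v = refl
  laplacian-star c (suc k) φ t f v =
    trans (laplacian-++ (replicate t (c , φ zero)) (star c k (φ ∘ suc) t) f v)
          (cong₂ _+_ (laplacian-replicate t c (φ zero) f v) (laplacian-star c k (φ ∘ suc) t f v))

  laplacian-star-centre : ∀ (c : Fin n) k φ t f → (∀ i → φ i ≢ c) →
    laplacian (star c k φ t) f c ≡ - (+ t * ΣFin k (λ i → f (φ i) - f c))
  laplacian-star-centre c k φ t f φ≢c = begin
    laplacian (star c k φ t) f c
      ≡⟨ laplacian-star c k φ t f c ⟩
    ΣFin k (λ i → + t * ((f c - f (φ i)) * δ c c + (f (φ i) - f c) * δ (φ i) c))
      ≡⟨ ΣFin-cong k (λ i → trans (cong₂ (λ α β → + t * ((f c - f (φ i)) * α + (f (φ i) - f c) * β)) (δ-same c) (δ-other (φ≢c i)))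
                                  (outward (+ t) (f c) (f (φ i)))) ⟩
    ΣFin k (λ i → -1ℤ * (+ t * (f (φ i) - f c)))
      ≡⟨ trans (ΣFin-* k -1ℤ _) (cong (-1ℤ *_) (ΣFin-* k (+ t) _)) ⟩
    -1ℤ * (+ t * ΣFin k (λ i → f (φ i) - f c))
      ≡⟨ ℤ.-1*i≡-i _ ⟩
    - (+ t * ΣFin k (λ i → f (φ i) - f c))
      ∎
    where
    open ≡-Reasoning
    outward : ∀ t x y → t * ((x - y) * 1ℤ + (y - x) * 0ℤ) ≡ -1ℤ * (t * (y - x))
    outward = solve-∀

  laplacian-star-leaf : ∀ (c : Fin n) k φ t f → (∀ {i j} → φ i ≡ φ j → i ≡ j) → (∀ i → c ≢ φ i) → ∀ j →
    laplacian (star c k φ t) f (φ j) ≡ + t * (f (φ j) - f c)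
  laplacian-star-leaf c k φ t f φ-injective c≢φ j = begin
    laplacian (star c k φ t) f (φ j)
      ≡⟨ laplacian-star c k φ t f (φ j) ⟩
    ΣFin k (λ i → + t * ((f c - f (φ i)) * δ c (φ j) + (f (φ i) - f c) * δ (φ i) (φ j)))
      ≡⟨ ΣFin-cong k (λ i → trans (cong₂ (λ α β → + t * ((f c - f (φ i)) * α + (f (φ i) - f c) * β))
                                           (δ-other (c≢φ j)) (trans (δ-injective φ-injective i j) (δ-sym i j)))
                                  (inward (+ t) (f c) (f (φ i)) (δ j i))) ⟩
    ΣFin k (λ i → + t * (f (φ i) - f c) * δ j i)
      ≡⟨ ΣFin-*-δ k (λ i → + t * (f (φ i) - f c)) j ⟩
    + t * (f (φ j) - f c)
      ∎
    where
    open ≡-Reasoning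
    inward : ∀ t x y α → t * ((x - y) * 0ℤ + (y - x) * α) ≡ t * (y - x) * α
    inward = solve-∀

  laplacian-star-away : ∀ (c : Fin n) k φ t f v → c ≢ v → (∀ i → φ i ≢ v) → laplacian (star c k φ t) f v ≡ 0ℤ
  laplacian-star-away c k φ t f v c≢v φ≢v = begin
    laplacian (star c k φ t) f v
      ≡⟨ laplacian-star c k φ t f v ⟩
    ΣFin k (λ i → + t * ((f c - f (φ i)) * δ c v + (f (φ i) - f c) * δ (φ i) v))
      ≡⟨ ΣFin-zero k (λ i → trans (cong₂ (λ α β → + t * ((f c - f (φ i)) * α + (f (φ i) - f c) * β)) (δ-other c≢v) (δ-other (φ≢v i)))
                                  (vanish (+ t) (f c) (f (φ i)))) ⟩
    0ℤ
      ∎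
    where
    open ≡-Reasoning
    vanish : ∀ t x y → t * ((x - y) * 0ℤ + (y - x) * 0ℤ) ≡ 0ℤ
    vanish = solve-∀

  ∈ᴱ-replicate : ∀ {t} {e : Fin n × Fin n} → 1 ℕ.≤ t → e ∈ᴱ replicate t e
  ∈ᴱ-replicate (ℕ.s≤s _) = here

  ∈ᴱ-⊆ : ∀ {e : Fin n × Fin n} {G′ G} → e ∈ᴱ G′ → G′ ⊆ G → e ∈ᴱ G
  ∈ᴱ-⊆ e∈G′         (_ ∷ʳ G′⊆G)   = there (∈ᴱ-⊆ e∈G′ G′⊆G)
  ∈ᴱ-⊆ here          (refl ∷ _)    = here
  ∈ᴱ-⊆ (there e∈G′) (refl ∷ G′⊆G) = there (∈ᴱ-⊆ e∈G′ G′⊆G)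

  reach-trans : ∀ {G : MultiGraph n} {u v w} → Reach G u v → Reach G v w → Reach G u w
  reach-trans rfl         q = q
  reach-trans (fwd e p) q = fwd e (reach-trans p q)
  reach-trans (bwd e p) q = bwd e (reach-trans p q)

  reach-sym : ∀ {G : MultiGraph n} {u v} → Reach G u v → Reach G v u
  reach-sym rfl       = rfl
  reach-sym (fwd e p) = reach-trans (reach-sym p) (bwd e rfl)
  reach-sym (bwd e p) = reach-trans (reach-sym p) (fwd e rfl)

  reach-∷ : ∀ {G : MultiGraph n} {e u v} → Reach G u v → Reach (e ∷ G) u v
  reach-∷ rfl       = rfl
  reach-∷ (fwd e p) = fwd (there e) (reach-∷ p)
  reach-∷ (bwd e p) = bwd (there e) (reach-∷ p)

  connected-from-root : ∀ {G : MultiGraph n} r → (∀ u → Reach G u r) → Connected G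
  connected-from-root r to-r u v = reach-trans (to-r u) (reach-sym (to-r v))

  loopless-replicate : ∀ k {a b : Fin n} → a ≢ b → Loopless (replicate k (a , b))
  loopless-replicate k a≢b = All.replicate⁺ k a≢b

  loopless-star : ∀ (c : Fin n) k φ t → (∀ i → c ≢ φ i) → Loopless (star c k φ t)
  loopless-star c zero    φ t c≢φ = []
  loopless-star c (suc k) φ t c≢φ = All.++⁺ (loopless-replicate t (c≢φ zero)) (loopless-star c k (φ ∘ suc) t (c≢φ ∘ suc))

module Construction (h : ℕ.ℕ) (1≤h : 1 ℕ.≤ h) where

  open ChipFiring

  open ℕ using (ℕ; zero; suc)
  import Data.Nat.Properties as ℕₚ
  open import Data.Integer
    using (ℤ; +_; 0ℤ; 1ℤ; -1ℤ; _+_; _-_; -_; _*_; _≤_; _<_; _≤?_; +≤+)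
  import Data.Integer.Properties as ℤ
  open import Data.Integer.Tactic.RingSolver using (solve-∀)
  open import Data.Fin using (Fin; zero; suc; _↑ˡ_; _↑ʳ_; splitAt)
  open import Data.Fin.Properties
    using (suc-injective; ↑ˡ-injective; ↑ʳ-injective; splitAt-↑ˡ; splitAt-↑ʳ; splitAt⁻¹-↑ˡ; splitAt⁻¹-↑ʳ)
  open import Data.List using (_∷_; _++_; replicate)
  open import Data.List.Relation.Binary.Sublist.Propositional using (_⊆_; _∷ʳ_; ⊆-refl)
  open import Data.List.Relation.Binary.Sublist.Propositional.Properties using (++⁺ˡ; ++⁺ʳ)
  open import Data.List.Relation.Unary.All using (_∷_)
  import Data.List.Relation.Unary.All.Properties as All
  open import Data.Product using (_,_)
  open import Data.Sum using (_⊎_; inj₁; inj₂; [_,_]′)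
  open import Function using (_∘_)
  open import Relation.Nullary using (yes; no; contradiction)
  open import Relation.Binary.PropositionalEquality
    using (_≡_; _≢_; refl; sym; trans; cong; cong₂; subst; module ≡-Reasoning)

  g m N : ℕ
  g = h ℕ.+ h
  m = g ℕ.+ h
  N = 3 ℕ.+ (m ℕ.+ m)

  1≤g : 1 ℕ.≤ g
  1≤g = ℕₚ.≤-trans 1≤h (ℕₚ.m≤m+n h h)

  1≤m : 1 ℕ.≤ m
  1≤m = ℕₚ.≤-trans 1≤g (ℕₚ.m≤m+n g h)

  -- The graphs

  X P Q : Fin N
  X = zero
  P = suc zero
  Q = suc (suc zero)

  Z W : Fin m → Fin N
  Z i = suc (suc (suc (i ↑ˡ m)))
  W j = suc (suc (suc (m ↑ʳ j)))

  Z-injective : ∀ {i j} → Z i ≡ Z j → i ≡ j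
  Z-injective = ↑ˡ-injective m _ _ ∘ suc-injective ∘ suc-injective ∘ suc-injective

  W-injective : ∀ {i j} → W i ≡ W j → i ≡ j
  W-injective = ↑ʳ-injective m _ _ ∘ suc-injective ∘ suc-injective ∘ suc-injective

  Z≢W : ∀ i j → Z i ≢ W j
  Z≢W i j Zi≡Wj with trans (sym (splitAt-↑ˡ m i m))
                         (trans (cong (splitAt m) (suc-injective (suc-injective (suc-injective Zi≡Wj))))
                                (splitAt-↑ʳ m m j))
  ... | ()

  data Vertex : Fin N → Set where
    atX : Vertex X
    atP : Vertex P
    atQ : Vertex Q
    atZ : ∀ i → Vertex (Z i)
    atW : ∀ j → Vertex (W j)

  vertex : ∀ u → Vertex u
  vertex zero             = atX
  vertex (suc zero)       = atP
  vertex (suc (suc zero)) = atQ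
  vertex (suc (suc (suc k))) with splitAt m k in eq
  ... | inj₁ i rewrite sym (splitAt⁻¹-↑ˡ eq) = atZ i
  ... | inj₂ j rewrite sym (splitAt⁻¹-↑ʳ eq) = atW j

  H G : MultiGraph N
  H = (X , P) ∷ replicate m (P , Q) ++ star X m Z g ++ star P m W h ++ star Q m W h
  G = (X , Q) ∷ H

  XZ⊆H : ∀ i → replicate g (X , Z i) ⊆ H
  XZ⊆H i = (X , P) ∷ʳ ++⁺ˡ (replicate m (P , Q)) (++⁺ʳ (star P m W h ++ star Q m W h) (replicate⊆star X m Z g i))

  PW⊆H : ∀ j → replicate h (P , W j) ⊆ H
  PW⊆H j = (X , P) ∷ʳ ++⁺ˡ (replicate m (P , Q)) (++⁺ˡ (star X m Z g) (++⁺ʳ (star Q m W h) (replicate⊆star P m W h j)))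

  PQ⊆H : replicate m (P , Q) ⊆ H
  PQ⊆H = (X , P) ∷ʳ ++⁺ʳ (star X m Z g ++ star P m W h ++ star Q m W h) ⊆-refl

  connected-H : Connected H
  connected-H = connected-from-root X to-X
    where
    to-X : ∀ u → Reach H u X
    to-X u with vertex u
    ... | atX   = rfl
    ... | atP   = bwd here rfl
    ... | atQ   = bwd (∈ᴱ-⊆ (∈ᴱ-replicate 1≤m) PQ⊆H) (bwd here rfl)
    ... | atZ i = bwd (∈ᴱ-⊆ (∈ᴱ-replicate 1≤g) (XZ⊆H i)) rfl
    ... | atW j = bwd (∈ᴱ-⊆ (∈ᴱ-replicate 1≤h) (PW⊆H j)) (bwd here rfl)

  connected-G : Connected G
  connected-G u v = reach-∷ (connected-H u v)

  loopless-G : Loopless G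
  loopless-G = (λ ()) ∷ (λ ()) ∷ All.++⁺ (loopless-replicate m (λ ()))
                                   (All.++⁺ (loopless-star X m Z g (λ _ ()))
                                            (All.++⁺ (loopless-star P m W h (λ _ ())) (loopless-star Q m W h (λ _ ()))))

  laplacian-H : ∀ f u → laplacian H f u ≡
    (f X - f P) * δ X u + (f P - f X) * δ P u
      + (laplacian (replicate m (P , Q)) f u
      + (laplacian (star X m Z g) f u + (laplacian (star P m W h) f u + laplacian (star Q m W h) f u)))
  laplacian-H f u =
    trans (laplacian-∷ X P (PQ ++ XZ ++ PW ++ QW) f u)
          (cong (_+_ ((f X - f P) * δ X u + (f P - f X) * δ P u))
                (trans (laplacian-++ PQ (XZ ++ PW ++ QW) f u)
                       (cong (_+_ (laplacian PQ f u))
                             (trans (laplacian-++ XZ (PW ++ QW) f u)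
                                    (cong (_+_ (laplacian XZ f u)) (laplacian-++ PW QW f u))))))
    where
    PQ XZ PW QW : MultiGraph N
    PQ = replicate m (P , Q)
    XZ = star X m Z g
    PW = star P m W h
    QW = star Q m W h

  laplacian-H-X : ∀ f → laplacian H f X ≡ (f X - f P) - + g * ΣFin m (λ k → f (Z k) - f X)
  laplacian-H-X f
    rewrite laplacian-H f X | laplacian-replicate m P Q f X
          | laplacian-star-centre X m Z g f (λ _ ())
          | laplacian-star-away P m W h f X (λ ()) (λ _ ()) | laplacian-star-away Q m W h f X (λ ()) (λ _ ())
    = simplify (f X) (f P) (f Q) (+ m) (+ g * ΣFin m (λ k → f (Z k) - f X))
    where
    simplify : ∀ x p q M S → (x - p) * 1ℤ + (p - x) * 0ℤ + (M * ((p - q) * 0ℤ + (q - p) * 0ℤ) + (- S + (0ℤ + 0ℤ))) ≡ (x - p) - S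
    simplify = solve-∀

  laplacian-H-P : ∀ f → laplacian H f P ≡ (f P - f X) + + m * (f P - f Q) - + h * ΣFin m (λ k → f (W k) - f P)
  laplacian-H-P f
    rewrite laplacian-H f P | laplacian-replicate m P Q f P
          | laplacian-star-away X m Z g f P (λ ()) (λ _ ())
          | laplacian-star-centre P m W h f (λ _ ())
          | laplacian-star-away Q m W h f P (λ ()) (λ _ ())
    = simplify (f X) (f P) (f Q) (+ m) (+ h * ΣFin m (λ k → f (W k) - f P))
    where
    simplify : ∀ x p q M S → (x - p) * 0ℤ + (p - x) * 1ℤ + (M * ((p - q) * 1ℤ + (q - p) * 0ℤ) + (0ℤ + (- S + 0ℤ))) ≡ (p - x) + M * (p - q) - S
    simplify = solve-∀

  laplacian-H-Q : ∀ f → laplacian H f Q ≡ + m * (f Q - f P) - + h * ΣFin m (λ k → f (W k) - f Q)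
  laplacian-H-Q f
    rewrite laplacian-H f Q | laplacian-replicate m P Q f Q
          | laplacian-star-away X m Z g f Q (λ ()) (λ _ ())
          | laplacian-star-away P m W h f Q (λ ()) (λ _ ())
          | laplacian-star-centre Q m W h f (λ _ ())
    = simplify (f X) (f P) (f Q) (+ m) (+ h * ΣFin m (λ k → f (W k) - f Q))
    where
    simplify : ∀ x p q M S → (x - p) * 0ℤ + (p - x) * 0ℤ + (M * ((p - q) * 0ℤ + (q - p) * 1ℤ) + (0ℤ + (0ℤ + - S))) ≡ M * (q - p) - S
    simplify = solve-∀

  laplacian-H-Z : ∀ f k → laplacian H f (Z k) ≡ + g * (f (Z k) - f X)
  laplacian-H-Z f k
    rewrite laplacian-H f (Z k) | laplacian-replicate m P Q f (Z k)
          | laplacian-star-leaf X m Z g f Z-injective (λ _ ()) k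
          | laplacian-star-away P m W h f (Z k) (λ ()) (λ j → Z≢W k j ∘ sym)
          | laplacian-star-away Q m W h f (Z k) (λ ()) (λ j → Z≢W k j ∘ sym)
    = simplify (f X) (f P) (f Q) (+ m) (+ g * (f (Z k) - f X))
    where
    simplify : ∀ x p q M L → (x - p) * 0ℤ + (p - x) * 0ℤ + (M * ((p - q) * 0ℤ + (q - p) * 0ℤ) + (L + (0ℤ + 0ℤ))) ≡ L
    simplify = solve-∀

  laplacian-H-W : ∀ f k → laplacian H f (W k) ≡ + h * (f (W k) - f P) + + h * (f (W k) - f Q)
  laplacian-H-W f k
    rewrite laplacian-H f (W k) | laplacian-replicate m P Q f (W k)
          | laplacian-star-away X m Z g f (W k) (λ ()) (λ i → Z≢W i k)
          | laplacian-star-leaf P m W h f W-injective (λ _ ()) k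
          | laplacian-star-leaf Q m W h f W-injective (λ _ ()) k
    = simplify (f X) (f P) (f Q) (+ m) (+ h * (f (W k) - f P)) (+ h * (f (W k) - f Q))
    where
    simplify : ∀ x p q M L L′ → (x - p) * 0ℤ + (p - x) * 0ℤ + (M * ((p - q) * 0ℤ + (q - p) * 0ℤ) + (0ℤ + (L + L′))) ≡ L + L′
    simplify = solve-∀

  laplacian-G : ∀ f u {l} → laplacian H f u ≡ l → laplacian G f u ≡ (f X - f Q) * δ X u + (f Q - f X) * δ Q u + l
  laplacian-G f u lap≡l =
    trans (laplacian-∷ X Q H f u) (cong (_+_ ((f X - f Q) * δ X u + (f Q - f X) * δ Q u)) lap≡l)

  laplacian-G-Z : ∀ f k → laplacian G f (Z k) ≡ + g * (f (Z k) - f X)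
  laplacian-G-Z f k = trans (laplacian-G f (Z k) (laplacian-H-Z f k)) (simplify (f X - f Q) (f Q - f X) (+ g * (f (Z k) - f X)))
    where
    simplify : ∀ a b l → a * 0ℤ + b * 0ℤ + l ≡ l
    simplify = solve-∀

  -- Upper bounds

  sideX : Fin N → ℤ
  sideX zero                = 1ℤ
  sideX (suc zero)          = 0ℤ
  sideX (suc (suc zero))    = 0ℤ
  sideX (suc (suc (suc k))) = [ (λ _ → 1ℤ) , (λ _ → 0ℤ) ]′ (splitAt m k)

  sideX-Z : ∀ i → sideX (Z i) ≡ 1ℤ
  sideX-Z i = cong [ (λ _ → 1ℤ) , (λ _ → 0ℤ) ]′ (splitAt-↑ˡ m i m)

  sideX-W : ∀ j → sideX (W j) ≡ 0ℤ
  sideX-W j = cong [ (λ _ → 1ℤ) , (λ _ → 0ℤ) ]′ (splitAt-↑ʳ m m j)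

  ΣZ-δZ : ∀ i → ΣFin m (λ k → δ (Z i) (Z k) - 0ℤ) ≡ 1ℤ
  ΣZ-δZ i = trans (ΣFin-cong m (λ k → trans (ℤ.+-identityʳ _) (δ-injective Z-injective i k))) (ΣFin-δ m i)

  ΣW-δW : ∀ j → ΣFin m (λ k → δ (W j) (W k) - 0ℤ) ≡ 1ℤ
  ΣW-δW j = trans (ΣFin-cong m (λ k → trans (ℤ.+-identityʳ _) (δ-injective W-injective j k))) (ΣFin-δ m j)

  ΣW-δZ : ∀ i → ΣFin m (λ k → δ (Z i) (W k) - 0ℤ) ≡ 0ℤ
  ΣW-δZ i = ΣFin-zero m (λ k → cong (_- 0ℤ) (δ-other (Z≢W i k)))

  ΣZ-δW : ∀ j → ΣFin m (λ k → δ (W j) (Z k) - 0ℤ) ≡ 0ℤ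
  ΣZ-δW j = ΣFin-zero m (λ k → cong (_- 0ℤ) (δ-other (Z≢W k j ∘ sym)))

  ΣZ-sideX : ΣFin m (λ k → sideX (Z k) - 1ℤ) ≡ 0ℤ
  ΣZ-sideX = ΣFin-zero m (λ k → cong (_- 1ℤ) (sideX-Z k))

  ΣW-sideX : ΣFin m (λ k → sideX (W k) - 0ℤ) ≡ 0ℤ
  ΣW-sideX = ΣFin-zero m (λ k → cong (_- 0ℤ) (sideX-W k))

  laplacian-δZ : ∀ i u → laplacian H (δ (Z i)) u ≡ + g * (δ (Z i) u - δ X u)
  laplacian-δZ i u with vertex u
  ... | atX = trans (laplacian-H-X (δ (Z i))) (trans (cong (λ s → (0ℤ - 0ℤ) - + g * s) (ΣZ-δZ i)) (evaluate (+ g)))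
    where
    evaluate : ∀ G → (0ℤ - 0ℤ) - G * 1ℤ ≡ G * (0ℤ - 1ℤ)
    evaluate = solve-∀
  ... | atP = trans (laplacian-H-P (δ (Z i))) (trans (cong (λ s → (0ℤ - 0ℤ) + + m * (0ℤ - 0ℤ) - + h * s) (ΣW-δZ i)) (evaluate (+ h) (+ m) (+ g)))
    where
    evaluate : ∀ H M G → (0ℤ - 0ℤ) + M * (0ℤ - 0ℤ) - H * 0ℤ ≡ G * (0ℤ - 0ℤ)
    evaluate = solve-∀
  ... | atQ = trans (laplacian-H-Q (δ (Z i))) (trans (cong (λ s → + m * (0ℤ - 0ℤ) - + h * s) (ΣW-δZ i)) (evaluate (+ h) (+ m) (+ g)))
    where
    evaluate : ∀ H M G → M * (0ℤ - 0ℤ) - H * 0ℤ ≡ G * (0ℤ - 0ℤ)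
    evaluate = solve-∀
  ... | atZ k = laplacian-H-Z (δ (Z i)) k
  ... | atW k rewrite laplacian-H-W (δ (Z i)) k | δ-other (Z≢W i k) = evaluate (+ h) (+ g)
    where
    evaluate : ∀ H G → H * (0ℤ - 0ℤ) + H * (0ℤ - 0ℤ) ≡ G * (0ℤ - 0ℤ)
    evaluate = solve-∀

  laplacian-δW : ∀ j u → laplacian H (δ (W j)) u ≡ + h * (δ (W j) u + δ (W j) u - δ P u - δ Q u)
  laplacian-δW j u with vertex u
  ... | atX = trans (laplacian-H-X (δ (W j))) (trans (cong (λ s → (0ℤ - 0ℤ) - + g * s) (ΣZ-δW j)) (evaluate (+ h) (+ g)))
    where
    evaluate : ∀ H G → (0ℤ - 0ℤ) - G * 0ℤ ≡ H * (0ℤ + 0ℤ - 0ℤ - 0ℤ)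
    evaluate = solve-∀
  ... | atP = trans (laplacian-H-P (δ (W j))) (trans (cong (λ s → (0ℤ - 0ℤ) + + m * (0ℤ - 0ℤ) - + h * s) (ΣW-δW j)) (evaluate (+ h) (+ m)))
    where
    evaluate : ∀ H M → (0ℤ - 0ℤ) + M * (0ℤ - 0ℤ) - H * 1ℤ ≡ H * (0ℤ + 0ℤ - 1ℤ - 0ℤ)
    evaluate = solve-∀
  ... | atQ = trans (laplacian-H-Q (δ (W j))) (trans (cong (λ s → + m * (0ℤ - 0ℤ) - + h * s) (ΣW-δW j)) (evaluate (+ h) (+ m)))
    where
    evaluate : ∀ H M → M * (0ℤ - 0ℤ) - H * 1ℤ ≡ H * (0ℤ + 0ℤ - 0ℤ - 1ℤ)
    evaluate = solve-∀
  ... | atZ k rewrite laplacian-H-Z (δ (W j)) k | δ-other (Z≢W k j ∘ sym) = evaluate (+ h) (+ g)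
    where
    evaluate : ∀ H G → G * (0ℤ - 0ℤ) ≡ H * (0ℤ + 0ℤ - 0ℤ - 0ℤ)
    evaluate = solve-∀
  ... | atW k = trans (laplacian-H-W (δ (W j)) k) (evaluate (+ h) (δ (W j) (W k)))
    where
    evaluate : ∀ H d → H * (d - 0ℤ) + H * (d - 0ℤ) ≡ H * (d + d - 0ℤ - 0ℤ)
    evaluate = solve-∀

  laplacian-sideX : ∀ u → laplacian H sideX u ≡ δ X u - δ P u
  laplacian-sideX u with vertex u
  ... | atX = trans (laplacian-H-X sideX) (trans (cong (λ s → (1ℤ - 0ℤ) - + g * s) ΣZ-sideX) (evaluate (+ g)))
    where
    evaluate : ∀ G → (1ℤ - 0ℤ) - G * 0ℤ ≡ 1ℤ - 0ℤ
    evaluate = solve-∀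
  ... | atP = trans (laplacian-H-P sideX) (trans (cong (λ s → (0ℤ - 1ℤ) + + m * (0ℤ - 0ℤ) - + h * s) ΣW-sideX) (evaluate (+ h) (+ m)))
    where
    evaluate : ∀ H M → (0ℤ - 1ℤ) + M * (0ℤ - 0ℤ) - H * 0ℤ ≡ 0ℤ - 1ℤ
    evaluate = solve-∀
  ... | atQ = trans (laplacian-H-Q sideX) (trans (cong (λ s → + m * (0ℤ - 0ℤ) - + h * s) ΣW-sideX) (evaluate (+ h) (+ m)))
    where
    evaluate : ∀ H M → M * (0ℤ - 0ℤ) - H * 0ℤ ≡ 0ℤ - 0ℤ
    evaluate = solve-∀
  ... | atZ k rewrite laplacian-H-Z sideX k | sideX-Z k = ℤ.*-zeroʳ (+ g)
  ... | atW k rewrite laplacian-H-W sideX k | sideX-W k = cong₂ _+_ (ℤ.*-zeroʳ (+ h)) (ℤ.*-zeroʳ (+ h))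

  pullZ pullW : Fin m → Fin N → ℤ
  pullZ i u = -1ℤ * δ (Z i) u
  pullW j u = + h * sideX u + -1ℤ * δ (W j) u

  laplacian-pullZ : ∀ i u → laplacian H (pullZ i) u ≡ -1ℤ * (+ g * (δ (Z i) u - δ X u))
  laplacian-pullZ i u = trans (laplacian-* H -1ℤ (δ (Z i)) u) (cong (-1ℤ *_) (laplacian-δZ i u))

  laplacian-pullW : ∀ j u → laplacian H (pullW j) u ≡
    + h * (δ X u - δ P u) + -1ℤ * (+ h * (δ (W j) u + δ (W j) u - δ P u - δ Q u))
  laplacian-pullW j u =
    trans (laplacian-+ H (λ u → + h * sideX u) (λ u → -1ℤ * δ (W j) u) u)
          (cong₂ _+_ (trans (laplacian-* H (+ h) sideX u) (cong (+ h *_) (laplacian-sideX u)))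
                     (trans (laplacian-* H -1ℤ (δ (W j)) u) (cong (-1ℤ *_) (laplacian-δW j u))))

  0≤h : 0ℤ ≤ + h
  0≤h = +≤+ ℕ.z≤n

  0≤g : 0ℤ ≤ + g
  0≤g = +≤+ ℕ.z≤n

  0≤g-1 : 0ℤ ≤ + g - 1ℤ
  0≤g-1 = ℤ.i≤j⇒0≤j-i (+≤+ 1≤g)

  0≤g-2 : 0ℤ ≤ + g - + 2
  0≤g-2 = ℤ.i≤j⇒0≤j-i (+≤+ (ℕₚ.+-mono-≤ 1≤h 1≤h))

  DG DH : Divisor N
  DG u = + g * δ X u
  DH u = + g * δ X u + + h * δ Q u

  DG-effective : Effective DG
  DG-effective u = nonneg-* 0≤g (δ-nonneg X u)

  DH-effective : Effective DH
  DH-effective u = ℤ.+-mono-≤ (nonneg-* 0≤g (δ-nonneg X u)) (nonneg-* 0≤h (δ-nonneg Q u))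

  1≤DG-X : 1ℤ ≤ DG X
  1≤DG-X = subst (1ℤ ≤_) (sym (ℤ.*-identityʳ (+ g))) (+≤+ 1≤g)

  1≤DH-X : 1ℤ ≤ DH X
  1≤DH-X = ℤ.≤-trans 1≤DG-X (≤-by-gap (+ h * 0ℤ) (nonneg-* 0≤h ℤ.≤-refl) refl)

  1≤DH-Q : 1ℤ ≤ DH Q
  1≤DH-Q = ℤ.≤-trans (subst (1ℤ ≤_) (sym (ℤ.*-identityʳ (+ h))) (+≤+ 1≤h))
                     (≤-by-gap (+ g * 0ℤ) (nonneg-* 0≤g ℤ.≤-refl) (ℤ.+-comm (+ h * 1ℤ) (+ g * 0ℤ)))

  certificateG-P : Certificate G DG P sideX
  certificateG-P = certificate λ u →
    subst (λ l → δ P u + l ≤ DG u) (sym (laplacian-G sideX u (laplacian-sideX u)))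
      (≤-by-gap ((+ g - + 2) * δ X u + δ Q u) (ℤ.+-mono-≤ (nonneg-* 0≤g-2 (δ-nonneg X u)) (δ-nonneg Q u))
                (balance (+ g) (δ X u) (δ P u) (δ Q u)))
    where
    balance : ∀ G x p q → p + ((1ℤ - 0ℤ) * x + (0ℤ - 1ℤ) * q + (x - p)) + ((G - + 2) * x + q) ≡ G * x
    balance = solve-∀

  certificateG-Q : Certificate G DG Q sideX
  certificateG-Q = certificate λ u →
    subst (λ l → δ Q u + l ≤ DG u) (sym (laplacian-G sideX u (laplacian-sideX u)))
      (≤-by-gap ((+ g - + 2) * δ X u + δ P u) (ℤ.+-mono-≤ (nonneg-* 0≤g-2 (δ-nonneg X u)) (δ-nonneg P u))
                (balance (+ g) (δ X u) (δ P u) (δ Q u)))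
    where
    balance : ∀ G x p q → q + ((1ℤ - 0ℤ) * x + (0ℤ - 1ℤ) * q + (x - p)) + ((G - + 2) * x + p) ≡ G * x
    balance = solve-∀

  certificateG-Z : ∀ i → Certificate G DG (Z i) (pullZ i)
  certificateG-Z i = certificate λ u →
    subst (λ l → δ (Z i) u + l ≤ DG u) (sym (laplacian-G (pullZ i) u (laplacian-pullZ i u)))
      (≤-by-gap ((+ g - 1ℤ) * δ (Z i) u) (nonneg-* 0≤g-1 (δ-nonneg (Z i) u))
                (balance (+ g) (δ X u) (δ Q u) (δ (Z i) u)))
    where
    balance : ∀ G x q z → z + ((0ℤ - 0ℤ) * x + (0ℤ - 0ℤ) * q + -1ℤ * (G * (z - x))) + (G - 1ℤ) * z ≡ G * x
    balance = solve-∀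

  certificateG-W : ∀ j → Certificate G DG (W j) (pullW j)
  certificateG-W j = certificate λ u →
    subst (λ l → δ (W j) u + l ≤ DG u) (sym (laplacian-G (pullW j) u (laplacian-pullW j u)))
      (≤-by-gap ((+ g - 1ℤ) * δ (W j) u) (nonneg-* 0≤g-1 (δ-nonneg (W j) u))
                (balance (+ h) (δ X u) (δ P u) (δ Q u) (δ (W j) u)))
    where
    balance : ∀ H x p q w →
      w + ((H * 1ℤ + -1ℤ * 0ℤ - (H * 0ℤ + -1ℤ * 0ℤ)) * x + (H * 0ℤ + -1ℤ * 0ℤ - (H * 1ℤ + -1ℤ * 0ℤ)) * q
           + (H * (x - p) + -1ℤ * (H * (w + w - p - q))))
        + ((H + H - 1ℤ) * w) ≡ (H + H) * x
    balance = solve-∀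

  certificateH-P : Certificate H DH P sideX
  certificateH-P = certificate λ u →
    subst (λ l → δ P u + l ≤ DH u) (sym (laplacian-sideX u))
      (≤-by-gap ((+ g - 1ℤ) * δ X u + + h * δ Q u) (ℤ.+-mono-≤ (nonneg-* 0≤g-1 (δ-nonneg X u)) (nonneg-* 0≤h (δ-nonneg Q u)))
                (balance (+ g) (+ h) (δ X u) (δ P u) (δ Q u)))
    where
    balance : ∀ G H x p q → p + (x - p) + ((G - 1ℤ) * x + H * q) ≡ G * x + H * q
    balance = solve-∀

  certificateH-Z : ∀ i → Certificate H DH (Z i) (pullZ i)
  certificateH-Z i = certificate λ u →
    subst (λ l → δ (Z i) u + l ≤ DH u) (sym (laplacian-pullZ i u))
      (≤-by-gap ((+ g - 1ℤ) * δ (Z i) u + + h * δ Q u) (ℤ.+-mono-≤ (nonneg-* 0≤g-1 (δ-nonneg (Z i) u)) (nonneg-* 0≤h (δ-nonneg Q u)))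
                (balance (+ g) (+ h) (δ X u) (δ Q u) (δ (Z i) u)))
    where
    balance : ∀ G H x q z → z + -1ℤ * (G * (z - x)) + ((G - 1ℤ) * z + H * q) ≡ G * x + H * q
    balance = solve-∀

  certificateH-W : ∀ j → Certificate H DH (W j) (pullW j)
  certificateH-W j = certificate λ u →
    subst (λ l → δ (W j) u + l ≤ DH u) (sym (laplacian-pullW j u))
      (≤-by-gap (+ h * δ X u + (+ g - 1ℤ) * δ (W j) u) (ℤ.+-mono-≤ (nonneg-* 0≤h (δ-nonneg X u)) (nonneg-* 0≤g-1 (δ-nonneg (W j) u)))
                (balance (+ h) (δ X u) (δ P u) (δ Q u) (δ (W j) u)))
    where
    balance : ∀ H x p q w → w + (H * (x - p) + -1ℤ * (H * (w + w - p - q))) + (H * x + (H + H - 1ℤ) * w) ≡ (H + H) * x + H * q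
    balance = solve-∀

  certifiedG : Certified G DG
  certifiedG v with vertex v
  ... | atX   = (λ _ → 0ℤ) , certificate-of-chip {G = G} {v = X} DG-effective 1≤DG-X
  ... | atP   = sideX , certificateG-P
  ... | atQ   = sideX , certificateG-Q
  ... | atZ i = pullZ i , certificateG-Z i
  ... | atW j = pullW j , certificateG-W j

  certifiedH : Certified H DH
  certifiedH v with vertex v
  ... | atX   = (λ _ → 0ℤ) , certificate-of-chip {G = H} {v = X} DH-effective 1≤DH-X
  ... | atP   = sideX , certificateH-P
  ... | atQ   = (λ _ → 0ℤ) , certificate-of-chip {G = H} {v = Q} DH-effective 1≤DH-Q
  ... | atZ i = pullZ i , certificateH-Z i
  ... | atW j = pullW j , certificateH-W j

  deg-DG : deg DG ≡ + g
  deg-DG = trans (ΣFin-* N (+ g) (δ X)) (trans (cong (+ g *_) (ΣFin-δ N X)) (ℤ.*-identityʳ (+ g)))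

  deg-DH : deg DH ≡ + m
  deg-DH = begin
    ΣFin N (λ u → + g * δ X u + + h * δ Q u)        ≡⟨ ΣFin-+ N (λ u → + g * δ X u) (λ u → + h * δ Q u) ⟩
    ΣFin N (λ u → + g * δ X u) + ΣFin N (λ u → + h * δ Q u)
      ≡⟨ cong₂ _+_ (trans (ΣFin-* N (+ g) (δ X)) (cong (+ g *_) (ΣFin-δ N X))) (trans (ΣFin-* N (+ h) (δ Q)) (cong (+ h *_) (ΣFin-δ N Q))) ⟩
    + g * 1ℤ + + h * 1ℤ                              ≡⟨ cong₂ _+_ (ℤ.*-identityʳ (+ g)) (ℤ.*-identityʳ (+ h)) ⟩
    + m                                              ∎
    where open ≡-Reasoning

  -- Lower bounds

  ΣZ ΣW : Divisor N → ℤ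
  ΣZ D = ΣFin m (D ∘ Z)
  ΣW D = ΣFin m (D ∘ W)

  deg-split : ∀ D → deg D ≡ D X + (D P + (D Q + (ΣZ D + ΣW D)))
  deg-split D = cong (λ s → D X + (D P + (D Q + s))) (ΣFin-↑ m m (λ k → D (suc (suc (suc k)))))

  ΣZ≤deg : ∀ D → Effective D → ΣZ D ≤ deg D
  ΣZ≤deg D effective =
    ≤-by-gap (D X + D P + D Q + ΣW D) (ℤ.+-mono-≤ (ℤ.+-mono-≤ (ℤ.+-mono-≤ (effective X) (effective P)) (effective Q)) (ΣFin-nonneg m (effective ∘ W)))
             (trans (regroup (D X) (D P) (D Q) (ΣZ D) (ΣW D)) (sym (deg-split D)))
    where
    regroup : ∀ x p q z w → z + (x + p + q + w) ≡ x + (p + (q + (z + w)))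
    regroup = solve-∀

  g≤m : + g ≤ + m
  g≤m = +≤+ (ℕₚ.m≤m+n g h)

  h≤m : + h ≤ + m
  h≤m = +≤+ (ℕₚ.m≤n+m h g)

  lowerG : ∀ D → Effective D → Certified G D → + g ≤ deg D
  lowerG D effective certs with ΣFin-zero-or-≥ m (effective ∘ Z)
  ... | inj₂ m≤ΣZ = ℤ.≤-trans g≤m (ℤ.≤-trans m≤ΣZ (ΣZ≤deg D effective))
  ... | inj₁ (i , DZi≡0) with certs (Z i)
  ...   | f , cert = bundle-bound effective (certificate-≤ cert) ((X , Q) ∷ʳ XZ⊆H i) fX≢fZi
    where
    drop : f (Z i) - f X ≤ -1ℤ
    drop = *-negative⇒≤-1 g (subst (_< 0ℤ) (laplacian-G-Z f i) (certificate-empty-target cert DZi≡0))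
    fX≢fZi : f X ≢ f (Z i)
    fX≢fZi fX≡fZi = contradiction (subst (_≤ -1ℤ) (trans (cong (_-_ (f (Z i))) fX≡fZi) (ℤ.+-inverseʳ (f (Z i)))) drop) λ ()

  two-regimes : ∀ {g h t a q w : ℤ} → t ≤ 0ℤ ⊎ h ≤ t → g - t ≤ a → t + t ≤ w → h ≤ q + w → 0ℤ ≤ q →
    g + h ≤ a + (q + w)
  two-regimes {g} {h} {t} {a} {q} {w} (inj₁ t≤0) g-t≤a _ h≤q+w _ = begin
    g + h              ≤⟨ ℤ.+-mono-≤ (≤-by-gap {g} (- t) (ℤ.neg-mono-≤ t≤0) refl) h≤q+w ⟩
    g + - t + (q + w)  ≤⟨ ℤ.+-monoˡ-≤ (q + w) g-t≤a ⟩
    a + (q + w)        ∎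
    where open ℤ.≤-Reasoning
  two-regimes {g} {h} {t} {a} {q} {w} (inj₂ h≤t) g-t≤a t+t≤w _ 0≤q = begin
    g + h                  ≤⟨ ℤ.+-monoʳ-≤ g h≤t ⟩
    g + t                  ≡⟨ regroup g t ⟩
    (g - t) + (t + t)      ≤⟨ ℤ.+-mono-≤ g-t≤a t+t≤w ⟩
    a + w                  ≤⟨ ℤ.+-monoʳ-≤ a (≤-by-gap q 0≤q (ℤ.+-comm w q)) ⟩
    a + (q + w)            ∎
    where
    open ℤ.≤-Reasoning
    regroup : ∀ g t → g + t ≡ (g - t) + (t + t)
    regroup = solve-∀

  module LowerBoundH (D : Divisor N) (effective : Effective D) (certs : Certified H D) (deg<m : deg D < + m) where

    rigid : ∀ {v f} → Certificate H D v f → f P ≡ f Q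
    rigid cert = bundle-rigid effective (certificate-≤ cert) PQ⊆H deg<m

    rise : (Fin N → ℤ) → ℤ
    rise f = ΣFin m (λ k → f (W k) - f P)

    laplacian-Q : ∀ {v f} → Certificate H D v f → laplacian H f Q ≡ - (+ h * rise f)
    laplacian-Q {f = f} cert =
      trans (laplacian-H-Q f)
            (trans (cong (λ q → + m * (q - f P) - + h * ΣFin m (λ k → f (W k) - q)) (sym (rigid cert)))
                   (simplify (+ m) (f P) (+ h * rise f)))
      where
      simplify : ∀ M p r → M * (p - p) - r ≡ - r
      simplify = solve-∀

    laplacian-W : ∀ {v f} → Certificate H D v f → ∀ k → laplacian H f (W k) ≡ + h * (f (W k) - f P) + + h * (f (W k) - f P)
    laplacian-W {f = f} cert k =
      trans (laplacian-H-W f k) (cong (λ q → + h * (f (W k) - f P) + + h * (f (W k) - q)) (sym (rigid cert)))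

    W-bound : ∀ {v f} → Certificate H D v f → + h * rise f + + h * rise f ≤ ΣW D
    W-bound {f = f} cert = subst (_≤ ΣW D) total (ΣFin-mono-≤ m (certificate-≤ cert ∘ W))
      where
      total : ΣFin m (λ k → laplacian H f (W k)) ≡ + h * rise f + + h * rise f
      total = trans (ΣFin-cong m (laplacian-W cert))
                    (trans (ΣFin-+ m (λ k → + h * (f (W k) - f P)) (λ k → + h * (f (W k) - f P)))
                           (cong₂ _+_ (ΣFin-* m (+ h) (λ k → f (W k) - f P)) (ΣFin-* m (+ h) (λ k → f (W k) - f P))))

    Z-side : ∀ {i f} → D (Z i) ≡ 0ℤ → Certificate H D (Z i) f → + g - + h * rise f ≤ D X + D P + ΣZ D
    Z-side {i} {f} DZi≡0 cert = begin
      + g - + h * rise f                                    ≤⟨ ℤ.+-monoˡ-≤ (- (+ h * rise f)) g≤ΣR ⟩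
      ΣFin m (R ∘ Z) - + h * rise f                         ≡⟨ cong (_- + h * rise f) ΣR≡ ⟩
      ΣZ D - + g * S - + h * rise f                         ≤⟨ ≤-by-gap (R X + R P) (ℤ.+-mono-≤ (certificate-residual cert X) (certificate-residual cert P)) refl ⟩
      ΣZ D - + g * S - + h * rise f + (R X + R P)
        ≡⟨ cong₂ (λ lx lp → ΣZ D - + g * S - + h * rise f + ((D X - lx) + (D P - lp))) (laplacian-H-X f)
                 (trans (laplacian-H-P f) (cong (λ q → (f P - f X) + + m * (f P - q) - + h * rise f) (sym (rigid cert)))) ⟩
      ΣZ D - + g * S - + h * rise f + ((D X - ((f X - f P) - + g * S)) + (D P - ((f P - f X) + + m * (f P - f P) - + h * rise f)))
        ≡⟨ cancel (ΣZ D) (+ g * S) (+ h * rise f) (D X) (D P) (f X) (f P) (+ m) ⟩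
      D X + D P + ΣZ D                                      ∎
      where
      open ℤ.≤-Reasoning
      R : Divisor N
      R u = D u - laplacian H f u
      S : ℤ
      S = ΣFin m (λ k → f (Z k) - f X)
      L≤-g : laplacian H f (Z i) ≤ - + g
      L≤-g = subst (_≤ - + g) (sym (laplacian-H-Z f i))
                   (*-negative⇒≤-k g (subst (_< 0ℤ) (laplacian-H-Z f i) (certificate-empty-target cert DZi≡0)))
      g≤ΣR : + g ≤ ΣFin m (R ∘ Z)
      g≤ΣR = ℤ.≤-trans (≤-0-minus DZi≡0 L≤-g) (ΣFin-≥-term m (certificate-residual cert ∘ Z) i)
      ΣR≡ : ΣFin m (R ∘ Z) ≡ ΣZ D - + g * S
      ΣR≡ = trans (ΣFin-minus m (D ∘ Z) (λ k → laplacian H f (Z k)))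
                  (cong (_-_ (ΣZ D)) (trans (ΣFin-cong m (laplacian-H-Z f)) (ΣFin-* m (+ g) (λ k → f (Z k) - f X))))
      cancel : ∀ z gS hr dx dp x p M →
        z - gS - hr + ((dx - ((x - p) - gS)) + (dp - ((p - x) + M * (p - p) - hr))) ≡ dx + dp + z
      cancel = solve-∀

    W-side : ∀ {j f} → D (W j) ≡ 0ℤ → Certificate H D (W j) f → + h ≤ ΣW D - + h * rise f
    W-side {j} {f} DWj≡0 cert = begin
      + h                                          ≤⟨ ≤-0-minus DWj≡0 tj≤-h ⟩
      D (W j) - t j                                ≤⟨ ΣFin-≥-term m slack-nonneg j ⟩
      ΣFin m (λ k → D (W k) - t k)                 ≡⟨ ΣFin-minus m (D ∘ W) t ⟩
      ΣW D - ΣFin m t                              ≡⟨ cong (_-_ (ΣW D)) (ΣFin-* m (+ h) (λ k → f (W k) - f P)) ⟩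
      ΣW D - + h * rise f                          ∎
      where
      open ℤ.≤-Reasoning
      t : Fin m → ℤ
      t k = + h * (f (W k) - f P)
      slack-nonneg : ∀ k → 0ℤ ≤ D (W k) - t k
      slack-nonneg k = ℤ.i≤j⇒0≤j-i (≤-half (effective (W k)) (subst (_≤ D (W k)) (laplacian-W cert k) (certificate-≤ cert (W k))))
      tj≤-h : t j ≤ - + h
      tj≤-h = *-negative⇒≤-k h (t+t<0⇒t<0 (subst (_< 0ℤ) (laplacian-W cert j) (certificate-empty-target cert DWj≡0)))

    QW-bound : + h ≤ D Q + ΣW D
    QW-bound with ΣFin-zero-or-≥ m (effective ∘ W)
    ... | inj₂ m≤ΣW = ℤ.≤-trans h≤m (ℤ.≤-trans m≤ΣW (≤-by-gap (D Q) (effective Q) (ℤ.+-comm (ΣW D) (D Q))))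
    ... | inj₁ (j , DWj≡0) with certs (W j)
    ...   | f , cert = begin
      + h                      ≤⟨ W-side DWj≡0 cert ⟩
      ΣW D - + h * rise f      ≡⟨ ℤ.+-comm (ΣW D) _ ⟩
      - (+ h * rise f) + ΣW D  ≤⟨ ℤ.+-monoˡ-≤ (ΣW D) (subst (_≤ D Q) (laplacian-Q cert) (certificate-≤ cert Q)) ⟩
      D Q + ΣW D               ∎
      where open ℤ.≤-Reasoning

    bound : + m ≤ deg D
    bound with ΣFin-zero-or-≥ m (effective ∘ Z)
    ... | inj₂ m≤ΣZ = ℤ.≤-trans m≤ΣZ (ΣZ≤deg D effective)
    ... | inj₁ (i , DZi≡0) with certs (Z i)
    ...   | f , cert = subst (+ m ≤_) (trans (regroup (D X) (D P) (D Q) (ΣZ D) (ΣW D)) (sym (deg-split D)))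
                             (two-regimes {+ g} (multiple-dichotomy h (rise f)) (Z-side DZi≡0 cert) (W-bound cert) QW-bound (effective Q))
      where
      regroup : ∀ x p q z w → x + p + z + (q + w) ≡ x + (p + (q + (z + w)))
      regroup = solve-∀

  lowerH : ∀ D → Effective D → Certified H D → + m ≤ deg D
  lowerH D effective certs with + m ≤? deg D
  ... | yes m≤deg = m≤deg
  ... | no  m≰deg = LowerBoundH.bound D effective certs (ℤ.≰⇒> m≰deg)

  gonality-G : IsGonality G g
  gonality-G = isGonality X DG certifiedG deg-DG lowerG

  gonality-H : IsGonality H m
  gonality-H = isGonality X DH certifiedH deg-DH lowerH

open import Data.Nat using (ℕ; _≤_; _+_)
open import Data.Product using (_×_; Σ; ∃-syntax; _,_)
open import Data.List using (length)
open import Data.Fin using (Fin; zero)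

theorem1p2 : (r : ℕ) → 1 ≤ r →
    ∃[ n ] Σ (MultiGraph n) λ G →
      Loopless G × Connected G ×
      ∃[ e ] (Connected (deleteEdge G e) ×
        ∃[ k ] (IsGonality G k × IsGonality (deleteEdge G e) (k + r)))
theorem1p2 r 1≤r = N , G , loopless-G , connected-G , zero , connected-H , g , gonality-G , gonality-H
  where open Construction r 1≤r
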